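{- Let $k\ge 3$ and let $P$ be a product of $k-2$ distinct primes, with largest prime factor $p$, and put $P_{k-3}=P/p$. Let $N(P)$ be the number of pairs of integers $(C,D)$ with $1\le D\le P-1$ and \[ \frac{(p-1)P^2-2P}{p+1}<CD<\frac{(p+3)P^2+2P}{p+1}.\] Then $N(P)=\Theta(P_{k-3}\,P\log P)$, and consequently $N(P)=O(P^{2-\frac{1}{k-2}}\log P)$.
   Context: These pairs $(C,D)$ are the candidate pairs generated by the "$CD$ method" for finding all absolute Lucas pseudoprimes of the form $Pqr$ ($q<r$ primes exceeding the prime factors of $P$). Asymptotic notation is as $P\to\infty$ (with $k$ fixed), with implied constants independent of $P$. -}

module Defs where

open import Data.Nat using (ℕ; zero; suc; _+_; _*_; _∸_; _<_; _<?_)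
open import Data.Nat.Properties using ()
open import Data.List using (List; length; filter; applyUpTo; map)
open import Data.Nat.ListAction using (sum)
open import Data.Product using (_×_)
open import Relation.Nullary.Decidable using (Dec; _×-dec_)

-- The window condition for a pair (C , D), for the given P and largest prime p:
--   ((p-1)P^2 - 2P)/(p+1) < C D < ((p+3)P^2 + 2P)/(p+1),
-- multiplied through by (p+1) > 0 and rearranged to avoid subtraction:
--   (p-1) P^2 < (p+1) C D + 2P   and   (p+1) C D < (p+3) P^2 + 2P.
InWindow : (P p C D : ℕ) → Set
InWindow P p C D =
  ((p ∸ 1) * (P * P) < (p + 1) * (C * D) + 2 * P)
  × ((p + 1) * (C * D) < (p + 3) * (P * P) + 2 * P)

inWindow? : (P p C D : ℕ) → Dec (InWindow P p C D)
inWindow? P p C D =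
  ((p ∸ 1) * (P * P) <? (p + 1) * (C * D) + 2 * P)
  ×-dec ((p + 1) * (C * D) <? (p + 3) * (P * P) + 2 * P)

-- Crude upper bound for C: any admissible C (with D ≥ 1) satisfies C < bound.
Cbound : (P p : ℕ) → ℕ
Cbound P p = (p + 3) * (P * P) + 2 * P

countC : (P p D : ℕ) → ℕ
countC P p D = length (filter (λ C → inWindow? P p C D) (applyUpTo suc (Cbound P p)))

-- N(P) = number of pairs (C , D) with 1 ≤ D ≤ P - 1, C ≥ 1, in the window
-- (C ≤ 0 is impossible since the lower bound of the window is ≥ 0 and D > 0).
N : (P p : ℕ) → ℕ
N P p = sum (map (countC P p) (applyUpTo suc (P ∸ 1)))

-- Fix D and put m = (p+1)D. Multiplying the window by p+1 shows that C is admissible exactly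
-- when (p-1)P² - 2P < mC ≤ (p+3)P² + 2P - 1, so the number of admissible C is the difference of
-- two floors ⌊·/m⌋ whose arguments differ by 4P(P+1) - 1. With P = Qp this count lies between
-- ⌊2PQ/D⌋ and ⌊4PQ/D⌋ + 1, so summing over D < P squeezes N(P) between two harmonic sums
-- Σ_{D<P} ⌊X/D⌋ with X of order PQ. Such a sum is Θ(X log P): splitting [1, n] at n/2, the upper
-- half contributes between X/4 and X, and log n drops by one. Finally Q ≤ p^(k-3) gives
-- Q^(k-2) ≤ P^(k-3), which turns N ≤ 9 QP log P into the bound on N^(k-2).

module Submission where

open import Defs
open import Data.Nat using (ℕ; _+_; _*_; _∸_; _^_; _≤_; _<_)
open import Data.Nat.Primality using (Prime)
open import Data.Nat.Logarithm using (⌊log₂_⌋)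
open import Data.List using (List; length)
open import Data.Nat.ListAction using (product)
open import Data.List.Relation.Unary.All using (All)
open import Data.List.Relation.Unary.Unique.Propositional using (Unique)
open import Data.Product using (_×_; ∃-syntax)
open import Relation.Binary.PropositionalEquality using (_≡_)

open import Data.Nat
open import Data.Nat.Properties
open import Data.Nat.DivMod
open import Data.Nat.Induction using (<-rec)
open import Data.Nat.Logarithm using (⌊log₂⌋-mono-≤; ⌊log₂⌊n/2⌋⌋≡⌊log₂n⌋∸1)
open import Data.Nat.Primality using (prime⇒nonTrivial)
open import Data.Nat.ListAction using (sum)
open import Data.Nat.Tactic.RingSolver using (solve-∀)
open import Data.Empty using (⊥-elim)
open import Data.List using ([]; _∷_; [_]; _++_; filter; applyUpTo)
open import Data.List.Properties using (applyUpTo-∷ʳ; map-applyUpTo; filter-++; filter-accept; filter-reject; length-++)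
open import Data.List.Relation.Unary.All as All using ([]; _∷_)
open import Data.Product using (_,_; proj₁; proj₂)
open import Data.Product.Function.NonDependent.Propositional using (_×-⇔_)
open import Function using (_∘_)
open import Function.Bundles using (_⇔_; mk⇔; Equivalence)
open import Function.Properties.Equivalence using () renaming (trans to ⇔-trans)
open import Level using (Level)
open import Relation.Binary.PropositionalEquality using (refl; sym; trans; cong; cong₂; subst; module ≡-Reasoning)
open import Relation.Nullary using (yes; no)
open import Relation.Unary using (Pred; Decidable)

open Equivalence using (to; from)

private
  variable
    ℓ : Level

m<n+o⇔m∸o<n : ∀ {m n o} → o ≤ m → m < n + o ⇔ m ∸ o < n
m<n+o⇔m∸o<n {m} {n} {o} o≤m = mk⇔
  (λ m<n+o → subst (m ∸ o <_) (m+n∸n≡m n o) (∸-monoˡ-< m<n+o o≤m))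
  (λ m∸o<n → subst (_< n + o) (m∸n+n≡m o≤m) (+-monoˡ-< o m∸o<n))

m<n⇔m≤n∸1 : ∀ {m n} → 1 ≤ n → m < n ⇔ m ≤ n ∸ 1
m<n⇔m≤n∸1 {n = suc n} _ = mk⇔ s≤s⁻¹ s≤s

n≤2*[n∸1] : ∀ n → 2 ≤ n → n ≤ 2 * (n ∸ 1)
n≤2*[n∸1] (2+ n) (s≤s (s≤s z≤n)) = subst (2+ n ≤_) (sym (double n)) (m≤m+n (2+ n) n)
  where
  double : ∀ n → 2 * suc n ≡ 2+ n + n
  double = solve-∀

m/o<n⇒m<n*o : ∀ {m n o} .{{_ : NonZero o}} → m / o < n → m < n * o
m/o<n⇒m<n*o {m} {n} {o} m/o<n = begin-strict
  m                 ≡⟨ m≡m%n+[m/n]*n m o ⟩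
  m % o + m / o * o <⟨ +-monoˡ-< (m / o * o) (m%n<n m o) ⟩
  suc (m / o) * o   ≤⟨ *-monoˡ-≤ o m/o<n ⟩
  n * o             ∎
  where open ≤-Reasoning

m<n*o⇔m/o<n : ∀ {m n o} .{{_ : NonZero o}} → m < n * o ⇔ m / o < n
m<n*o⇔m/o<n = mk⇔ m<n*o⇒m/o<n m/o<n⇒m<n*o

m*o≤n⇔m≤n/o : ∀ {m n o} .{{_ : NonZero o}} → m * o ≤ n ⇔ m ≤ n / o
m*o≤n⇔m≤n/o {m} {n} {o} = mk⇔
  (λ m*o≤n → subst (_≤ n / o) (m*n/n≡m m o) (/-monoˡ-≤ o m*o≤n))
  (λ m≤n/o → ≤-trans (*-monoˡ-≤ o m≤n/o) (m/n*n≤m n o))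

[m∸n]/o≤m/o∸n/o : ∀ m n o .{{_ : NonZero o}} → (m ∸ n) / o ≤ m / o ∸ n / o
[m∸n]/o≤m/o∸n/o m n o with n ≤? m
... | yes n≤m = m+n≤o⇒m≤o∸n _ (to m*o≤n⇔m≤n/o (begin
  ((m ∸ n) / o + n / o) * o       ≡⟨ *-distribʳ-+ o ((m ∸ n) / o) (n / o) ⟩
  (m ∸ n) / o * o + n / o * o     ≤⟨ +-mono-≤ (m/n*n≤m (m ∸ n) o) (m/n*n≤m n o) ⟩
  (m ∸ n) + n                     ≡⟨ m∸n+n≡m n≤m ⟩
  m                               ∎))
  where open ≤-Reasoning
... | no n≰m = subst (_≤ m / o ∸ n / o) (sym (trans (cong (_/ o) (m≤n⇒m∸n≡0 (≰⇒≥ n≰m))) (0/n≡0 o))) z≤n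

m/o∸n/o≤1+[m∸n]/o : ∀ m n o .{{_ : NonZero o}} → m / o ∸ n / o ≤ suc ((m ∸ n) / o)
m/o∸n/o≤1+[m∸n]/o m n o = m≤n+o⇒m∸n≤o (m / o) (n / o) (s≤s⁻¹ (to m<n*o⇔m/o<n (begin-strict
  m                                          ≤⟨ m≤n+m∸n m n ⟩
  n + (m ∸ n)                                <⟨ +-mono-< (m/o<n⇒m<n*o ≤-refl) (m/o<n⇒m<n*o ≤-refl) ⟩
  suc (n / o) * o + suc ((m ∸ n) / o) * o    ≡⟨ *-distribʳ-+ o (suc (n / o)) (suc ((m ∸ n) / o)) ⟨
  (suc (n / o) + suc ((m ∸ n) / o)) * o      ∎)))
  where open ≤-Reasoning

2*n≤m⇒m<2*[m/n*n] : ∀ m n .{{_ : NonZero n}} → 2 * n ≤ m → m < 2 * (m / n * n)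
2*n≤m⇒m<2*[m/n*n] m n 2n≤m = +-cancelˡ-< m m (2 * (m / n * n)) (begin-strict
  m + m                               <⟨ +-mono-< m<n+q m<n+q ⟩
  (n + m / n * n) + (n + m / n * n)   ≡⟨ regroup n (m / n * n) ⟩
  2 * n + 2 * (m / n * n)             ≤⟨ +-monoˡ-≤ _ 2n≤m ⟩
  m + 2 * (m / n * n)                 ∎)
  where
  open ≤-Reasoning
  m<n+q : m < n + m / n * n
  m<n+q = m/o<n⇒m<n*o ≤-refl
  regroup : ∀ a b → (a + b) + (a + b) ≡ 2 * a + 2 * b
  regroup = solve-∀

⌊n/2⌋≤n∸1 : ∀ n → ⌊ n /2⌋ ≤ n ∸ 1
⌊n/2⌋≤n∸1 zero    = z≤n
⌊n/2⌋≤n∸1 (suc n) = s≤s⁻¹ (⌊n/2⌋<n n)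

⌊log₂n⌋≡1+⌊log₂⌊n/2⌋⌋ : ∀ n → 2 ≤ n → ⌊log₂ n ⌋ ≡ suc ⌊log₂ ⌊ n /2⌋ ⌋
⌊log₂n⌋≡1+⌊log₂⌊n/2⌋⌋ n 2≤n = begin
  ⌊log₂ n ⌋                  ≡⟨ m+[n∸m]≡n (⌊log₂⌋-mono-≤ 2≤n) ⟨
  suc (⌊log₂ n ⌋ ∸ 1)        ≡⟨ cong suc (⌊log₂⌊n/2⌋⌋≡⌊log₂n⌋∸1 n) ⟨
  suc ⌊log₂ ⌊ n /2⌋ ⌋        ∎
  where open ≡-Reasoning

⌊log₂n⌋∸1≤⌊log₂[n∸1]⌋ : ∀ n → ⌊log₂ n ⌋ ∸ 1 ≤ ⌊log₂ (n ∸ 1) ⌋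
⌊log₂n⌋∸1≤⌊log₂[n∸1]⌋ n = subst (_≤ ⌊log₂ (n ∸ 1) ⌋) (⌊log₂⌊n/2⌋⌋≡⌊log₂n⌋∸1 n) (⌊log₂⌋-mono-≤ (⌊n/2⌋≤n∸1 n))

[m*n]^o≡m^o*n^o : ∀ m n o → (m * n) ^ o ≡ m ^ o * n ^ o
[m*n]^o≡m^o*n^o m n zero    = refl
[m*n]^o≡m^o*n^o m n (suc o) = trans (cong (m * n *_) ([m*n]^o≡m^o*n^o m n o)) (interchange m n (m ^ o) (n ^ o))
  where
  interchange : ∀ a b x y → a * b * (x * y) ≡ a * x * (b * y)
  interchange = solve-∀

product≤^length : ∀ {p} qs → All (_≤ p) qs → product qs ≤ p ^ length qs
product≤^length []       []           = ≤-refl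
product≤^length (q ∷ qs) (q≤p ∷ qs≤p) = *-mono-≤ q≤p (product≤^length qs qs≤p)

m≤n^o⇒m^[1+o]≤[m*n]^o : ∀ Q p t → Q ≤ p ^ t → Q ^ suc t ≤ (Q * p) ^ t
m≤n^o⇒m^[1+o]≤[m*n]^o Q p t Q≤p^t = begin
  Q * Q ^ t        ≤⟨ *-monoˡ-≤ (Q ^ t) Q≤p^t ⟩
  p ^ t * Q ^ t    ≡⟨ *-comm (p ^ t) (Q ^ t) ⟩
  Q ^ t * p ^ t    ≡⟨ [m*n]^o≡m^o*n^o Q p t ⟨
  (Q * p) ^ t      ∎
  where open ≤-Reasoning

module _ {R : Pred ℕ ℓ} (R? : Decidable R) where

  length-filter-applyUpTo-suc : ∀ K → length (filter R? (applyUpTo suc (suc K)))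
    ≡ length (filter R? (applyUpTo suc K)) + length (filter R? [ suc K ])
  length-filter-applyUpTo-suc K = begin
    length (filter R? (applyUpTo suc (suc K)))                    ≡⟨ cong (length ∘ filter R?) (applyUpTo-∷ʳ suc K) ⟨
    length (filter R? (applyUpTo suc K ++ [ suc K ]))             ≡⟨ cong length (filter-++ R? (applyUpTo suc K) [ suc K ]) ⟩
    length (filter R? (applyUpTo suc K) ++ filter R? [ suc K ])   ≡⟨ length-++ (filter R? (applyUpTo suc K)) ⟩
    length (filter R? (applyUpTo suc K)) + length (filter R? [ suc K ]) ∎
    where open ≡-Reasoning

  length-filter-interval : ∀ {lo hi} → (∀ C → R C ⇔ (lo < C × C ≤ hi)) →
    ∀ K → length (filter R? (applyUpTo suc K)) ≡ K ⊓ hi ∸ lo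
  length-filter-interval {lo} {hi} R⇔ zero = sym (0∸n≡0 lo)
  length-filter-interval {lo} {hi} R⇔ (suc K) with R? (suc K) | length-filter-interval R⇔ K
  ... | yes r | ih = begin
    length (filter R? (applyUpTo suc (suc K)))      ≡⟨ length-filter-applyUpTo-suc K ⟩
    length (filter R? (applyUpTo suc K)) + length (filter R? [ suc K ])
                                                    ≡⟨ cong₂ _+_ ih (cong length (filter-accept R? {xs = []} r)) ⟩
    K ⊓ hi ∸ lo + 1                                 ≡⟨ cong (λ x → x ∸ lo + 1) (m≤n⇒m⊓n≡m K≤hi) ⟩
    K ∸ lo + 1                                      ≡⟨ +-∸-comm 1 (s≤s⁻¹ lo<1+K) ⟨
    K + 1 ∸ lo                                      ≡⟨ cong (_∸ lo) (trans (+-comm K 1) (sym (m≤n⇒m⊓n≡m 1+K≤hi))) ⟩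
    suc K ⊓ hi ∸ lo                                 ∎
    where
    open ≡-Reasoning
    lo<1+K : lo < suc K
    lo<1+K = proj₁ (to (R⇔ (suc K)) r)
    1+K≤hi : suc K ≤ hi
    1+K≤hi = proj₂ (to (R⇔ (suc K)) r)
    K≤hi : K ≤ hi
    K≤hi = ≤-trans (n≤1+n K) 1+K≤hi
  ... | no ¬r | ih = begin
    length (filter R? (applyUpTo suc (suc K)))      ≡⟨ length-filter-applyUpTo-suc K ⟩
    length (filter R? (applyUpTo suc K)) + length (filter R? [ suc K ])
                                                    ≡⟨ cong₂ _+_ ih (cong length (filter-reject R? {xs = []} ¬r)) ⟩
    K ⊓ hi ∸ lo + 0                                 ≡⟨ +-identityʳ _ ⟩
    K ⊓ hi ∸ lo                                     ≡⟨ unchanged ⟩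
    suc K ⊓ hi ∸ lo                                 ∎
    where
    open ≡-Reasoning
    unchanged : K ⊓ hi ∸ lo ≡ suc K ⊓ hi ∸ lo
    unchanged with suc K ≤? hi | lo <? suc K
    ... | yes 1+K≤hi | yes lo<1+K = ⊥-elim (¬r (from (R⇔ (suc K)) (lo<1+K , 1+K≤hi)))
    ... | yes _ | no lo≮1+K = trans (m≤n⇒m∸n≡0 (≤-trans (m⊓n≤m K hi) (≤-trans (n≤1+n K) 1+K≤lo)))
                                     (sym (m≤n⇒m∸n≡0 (≤-trans (m⊓n≤m (suc K) hi) 1+K≤lo)))
      where
      1+K≤lo : suc K ≤ lo
      1+K≤lo = ≮⇒≥ lo≮1+K
    ... | no 1+K≰hi | _ = cong (_∸ lo) (trans (m≥n⇒m⊓n≡n hi≤K) (sym (m≥n⇒m⊓n≡n (≤-trans hi≤K (n≤1+n K)))))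
      where
      hi≤K : hi ≤ K
      hi≤K = s≤s⁻¹ (≰⇒> 1+K≰hi)

sum-applyUpTo-+ : ∀ (f : ℕ → ℕ) m n →
  sum (applyUpTo f (m + n)) ≡ sum (applyUpTo f m) + sum (applyUpTo (λ i → f (m + i)) n)
sum-applyUpTo-+ f zero    n = refl
sum-applyUpTo-+ f (suc m) n = trans (cong (f 0 +_) (sum-applyUpTo-+ (f ∘ suc) m n))
                                    (sym (+-assoc (f 0) _ _))

sum-applyUpTo-const : ∀ c n → sum (applyUpTo (λ _ → c) n) ≡ n * c
sum-applyUpTo-const c zero    = refl
sum-applyUpTo-const c (suc n) = cong (c +_) (sum-applyUpTo-const c n)

sum-applyUpTo-distrib-+ : ∀ (f g : ℕ → ℕ) n →
  sum (applyUpTo (λ i → f i + g i) n) ≡ sum (applyUpTo f n) + sum (applyUpTo g n)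
sum-applyUpTo-distrib-+ f g zero    = refl
sum-applyUpTo-distrib-+ f g (suc n) =
  trans (cong (f 0 + g 0 +_) (sum-applyUpTo-distrib-+ (f ∘ suc) (g ∘ suc) n))
        (+-interchange (f 0) (g 0) _ _)
  where
  +-interchange : ∀ a b c d → (a + b) + (c + d) ≡ (a + c) + (b + d)
  +-interchange = solve-∀

sum-applyUpTo-mono-≤ : ∀ {f g : ℕ → ℕ} n → (∀ i → i < n → f i ≤ g i) →
  sum (applyUpTo f n) ≤ sum (applyUpTo g n)
sum-applyUpTo-mono-≤         zero    f≤g = z≤n
sum-applyUpTo-mono-≤ {f} {g} (suc n) f≤g =
  +-mono-≤ (f≤g 0 z<s) (sum-applyUpTo-mono-≤ {f ∘ suc} {g ∘ suc} n (λ i i<n → f≤g (suc i) (s<s i<n)))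

harmonic : ℕ → ℕ → ℕ
harmonic X n = sum (applyUpTo (λ i → X / suc i) n)

harmonic-halves : ∀ X n → harmonic X n
  ≡ harmonic X ⌊ n /2⌋ + sum (applyUpTo (λ i → X / suc (⌊ n /2⌋ + i)) ⌈ n /2⌉)
harmonic-halves X n = trans (cong (harmonic X) (sym (⌊n/2⌋+⌈n/2⌉≡n n)))
                            (sum-applyUpTo-+ (λ i → X / suc i) ⌊ n /2⌋ ⌈ n /2⌉)

harmonic-≤ : ∀ X n → harmonic X n ≤ X * suc ⌊log₂ n ⌋
harmonic-≤ X = <-rec _ step
  where
  step : ∀ n → (∀ {m} → m < n → harmonic X m ≤ X * suc ⌊log₂ m ⌋) → harmonic X n ≤ X * suc ⌊log₂ n ⌋
  step zero          _  = z≤n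
  step (suc zero)    _  = ≤-reflexive (trans (+-identityʳ (X / 1)) (trans (n/1≡n X) (sym (*-identityʳ X))))
  step n@(2+ n-2)    ih = begin
    harmonic X n                  ≡⟨ harmonic-halves X n ⟩
    harmonic X h + tail           ≤⟨ +-mono-≤ (ih (⌊n/2⌋<n (suc n-2))) tail≤X ⟩
    X * suc ⌊log₂ h ⌋ + X         ≡⟨ trans (+-comm _ X) (sym (*-suc X _)) ⟩
    X * suc (suc ⌊log₂ h ⌋)       ≡⟨ cong (λ l → X * suc l) (⌊log₂n⌋≡1+⌊log₂⌊n/2⌋⌋ n (s≤s (s≤s z≤n))) ⟨
    X * suc ⌊log₂ n ⌋             ∎
    where
    open ≤-Reasoning
    h j tail : ℕ
    h = ⌊ n /2⌋
    j = ⌈ n /2⌉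
    tail = sum (applyUpTo (λ i → X / suc (h + i)) j)
    tail≤X : tail ≤ X
    tail≤X = begin
      tail                                  ≤⟨ sum-applyUpTo-mono-≤ j (λ i _ → /-monoʳ-≤ X (s≤s (m≤m+n h i))) ⟩
      sum (applyUpTo (λ _ → X / suc h) j)   ≡⟨ sum-applyUpTo-const (X / suc h) j ⟩
      j * (X / suc h)                       ≤⟨ *-monoˡ-≤ (X / suc h) (⌊n/2⌋-mono (n≤1+n (suc n))) ⟩
      suc h * (X / suc h)                   ≡⟨ *-comm (suc h) (X / suc h) ⟩
      X / suc h * suc h                     ≤⟨ m/n*n≤m X (suc h) ⟩
      X                                     ∎

harmonic-≥ : ∀ X n → 2 * n ≤ X → X * ⌊log₂ n ⌋ ≤ 4 * harmonic X n
harmonic-≥ X = <-rec _ step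
  where
  step : ∀ n → (∀ {m} → m < n → 2 * m ≤ X → X * ⌊log₂ m ⌋ ≤ 4 * harmonic X m) →
         2 * n ≤ X → X * ⌊log₂ n ⌋ ≤ 4 * harmonic X n
  step zero       _  _    = ≤-reflexive (*-zeroʳ X)
  step (suc zero) _  _    = ≤-trans (≤-reflexive (*-zeroʳ X)) z≤n
  step n@(2+ n-2) ih 2n≤X = begin
    X * ⌊log₂ n ⌋                           ≡⟨ cong (X *_) (⌊log₂n⌋≡1+⌊log₂⌊n/2⌋⌋ n (s≤s (s≤s z≤n))) ⟩
    X * suc ⌊log₂ h ⌋                       ≡⟨ *-suc X _ ⟩
    X + X * ⌊log₂ h ⌋                       ≤⟨ +-mono-≤ X≤4j[X/n] (ih (⌊n/2⌋<n (suc n-2)) 2h≤X) ⟩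
    4 * (j * (X / n)) + 4 * harmonic X h    ≡⟨ *-distribˡ-+ 4 (j * (X / n)) (harmonic X h) ⟨
    4 * (j * (X / n) + harmonic X h)        ≤⟨ *-monoʳ-≤ 4 (+-monoˡ-≤ _ j*[X/n]≤tail) ⟩
    4 * (tail + harmonic X h)               ≡⟨ cong (4 *_) (trans (+-comm tail _) (sym (harmonic-halves X n))) ⟩
    4 * harmonic X n                        ∎
    where
    open ≤-Reasoning
    h j tail : ℕ
    h = ⌊ n /2⌋
    j = ⌈ n /2⌉
    tail = sum (applyUpTo (λ i → X / suc (h + i)) j)
    2h≤X : 2 * h ≤ X
    2h≤X = ≤-trans (*-monoʳ-≤ 2 (⌊n/2⌋≤n n)) 2n≤X
    n≤2j : n ≤ 2 * j
    n≤2j = begin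
      n         ≡⟨ ⌊n/2⌋+⌈n/2⌉≡n n ⟨
      h + j     ≤⟨ +-monoˡ-≤ j (⌊n/2⌋≤⌈n/2⌉ n) ⟩
      j + j     ≡⟨ cong (j +_) (+-identityʳ j) ⟨
      2 * j     ∎
    X≤4j[X/n] : X ≤ 4 * (j * (X / n))
    X≤4j[X/n] = begin
      X                      ≤⟨ <⇒≤ (2*n≤m⇒m<2*[m/n*n] X n 2n≤X) ⟩
      2 * (X / n * n)        ≤⟨ *-monoʳ-≤ 2 (*-monoʳ-≤ (X / n) n≤2j) ⟩
      2 * (X / n * (2 * j))  ≡⟨ regroup (X / n) j ⟩
      4 * (j * (X / n))      ∎
      where
      regroup : ∀ q j → 2 * (q * (2 * j)) ≡ 4 * (j * q)
      regroup = solve-∀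
    j*[X/n]≤tail : j * (X / n) ≤ tail
    j*[X/n]≤tail = begin
      j * (X / n)                             ≡⟨ sum-applyUpTo-const (X / n) j ⟨
      sum (applyUpTo (λ _ → X / n) j)         ≤⟨ sum-applyUpTo-mono-≤ j (λ i i<j → /-monoʳ-≤ X (h+i<n i<j)) ⟩
      tail                                    ∎
      where
      h+i<n : ∀ {i} → i < j → h + i < n
      h+i<n {i} i<j = subst (h + i <_) (⌊n/2⌋+⌈n/2⌉≡n n) (+-monoʳ-< h i<j)

windowLo windowHi : ℕ → ℕ → ℕ
windowLo P p = (p ∸ 1) * (P * P) ∸ 2 * P
windowHi P p = Cbound P p ∸ 1

inWindow⇔ : ∀ P p C D → 2 * P ≤ (p ∸ 1) * (P * P) → 1 ≤ Cbound P p →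
  InWindow P p C D ⇔ (windowLo P p < C * (suc p * D) × C * (suc p * D) ≤ windowHi P p)
inWindow⇔ P p C D 2P≤a 1≤b =
  subst (λ u → InWindow P p C D ⇔ (windowLo P p < u × u ≤ windowHi P p))
        (scale p C D)
        (m<n+o⇔m∸o<n 2P≤a ×-⇔ m<n⇔m≤n∸1 1≤b)
  where
  scale : ∀ p C D → (p + 1) * (C * D) ≡ C * (suc p * D)
  scale = solve-∀

countC≡ : ∀ P p d → 2 * P ≤ (p ∸ 1) * (P * P) → 1 ≤ Cbound P p →
  countC P p (suc d) ≡ windowHi P p / (suc p * suc d) ∸ windowLo P p / (suc p * suc d)
countC≡ P p d 2P≤a 1≤b =
  trans (length-filter-interval (λ C → inWindow? P p C (suc d)) window (Cbound P p))
        (cong (_∸ windowLo P p / m) (m≥n⇒m⊓n≡n (≤-trans (m/n≤m (windowHi P p) m) (m∸n≤m (Cbound P p) 1))))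
  where
  m : ℕ
  m = suc p * suc d
  window : ∀ C → InWindow P p C (suc d) ⇔ (windowLo P p / m < C × C ≤ windowHi P p / m)
  window C = ⇔-trans (inWindow⇔ P p C (suc d) 2P≤a 1≤b) (m<n*o⇔m/o<n ×-⇔ m*o≤n⇔m≤n/o)

windowHi∸windowLo : ∀ P p → 1 ≤ p → 2 * P ≤ (p ∸ 1) * (P * P) →
  windowHi P p ∸ windowLo P p ≡ 4 * P * (P + 1) ∸ 1
windowHi∸windowLo P (suc p) _ 2P≤a = begin
  b ∸ 1 ∸ x                        ≡⟨ ∸-+-assoc b 1 x ⟩
  b ∸ (1 + x)                      ≡⟨ cong₂ _∸_ b≡x+w (+-comm 1 x) ⟩
  (x + 4 * P * (P + 1)) ∸ (x + 1)  ≡⟨ [m+n]∸[m+o]≡n∸o x (4 * P * (P + 1)) 1 ⟩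
  4 * P * (P + 1) ∸ 1              ∎
  where
  open ≡-Reasoning
  b x : ℕ
  b = Cbound P (suc p)
  x = windowLo P (suc p)
  expand : ∀ p P → (suc p + 3) * (P * P) + 2 * P ≡ p * (P * P) + (4 * (P * P) + 2 * P)
  expand = solve-∀
  regroup : ∀ x P → x + 2 * P + (4 * (P * P) + 2 * P) ≡ x + 4 * P * (P + 1)
  regroup = solve-∀
  b≡x+w : b ≡ x + 4 * P * (P + 1)
  b≡x+w = begin
    b                                       ≡⟨ expand p P ⟩
    p * (P * P) + (4 * (P * P) + 2 * P)     ≡⟨ cong (_+ (4 * (P * P) + 2 * P)) (m∸n+n≡m 2P≤a) ⟨
    x + 2 * P + (4 * (P * P) + 2 * P)       ≡⟨ regroup x P ⟩
    x + 4 * P * (P + 1)                     ∎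

2*P≤[p∸1]*[P*P] : ∀ P p → 2 ≤ P → 2 ≤ p → 2 * P ≤ (p ∸ 1) * (P * P)
2*P≤[p∸1]*[P*P] P (2+ p) 2≤P (s≤s (s≤s z≤n)) = ≤-trans (*-monoˡ-≤ P 2≤P) (m≤n*m (P * P) (suc p))

module _ (Q : ℕ) {p : ℕ} (2≤p : 2 ≤ p) (4≤P : 4 ≤ Q * p) where

  private
    P : ℕ
    P = Q * p

    instance
      Q≢0 : NonZero Q
      Q≢0 = m*n≢0⇒m≢0 Q {{>-nonZero (≤-trans (s≤s z≤n) 4≤P)}}
      p≢0 : NonZero p
      p≢0 = >-nonZero (≤-trans (s≤s z≤n) 2≤p)

    1≤Q : 1 ≤ Q
    1≤Q = >-nonZero⁻¹ Q

    2≤P : 2 ≤ P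
    2≤P = ≤-trans (s≤s (s≤s z≤n)) 4≤P

    2P≤a : 2 * P ≤ (p ∸ 1) * (P * P)
    2P≤a = 2*P≤[p∸1]*[P*P] P p 2≤P 2≤p

    1≤b : 1 ≤ Cbound P p
    1≤b = ≤-trans (≤-trans (s≤s z≤n) 2≤P) (≤-trans (m≤n*m P 2) (m≤n+m (2 * P) ((p + 3) * (P * P))))

    scale : ∀ c → suc p * (c * P * Q) ≡ c * P * (P + Q)
    scale c = identity c Q p
      where
      identity : ∀ c Q p → suc p * (c * (Q * p) * Q) ≡ c * (Q * p) * (Q * p + Q)
      identity = solve-∀

    width : windowHi P p ∸ windowLo P p ≡ 4 * P * (P + 1) ∸ 1
    width = windowHi∸windowLo P p (≤-trans (s≤s z≤n) 2≤p) 2P≤a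

  countC-≥ : ∀ d → (2 * P * Q) / suc d ≤ countC P p (suc d)
  countC-≥ d = begin
    (2 * P * Q) / suc d                  ≡⟨ m*n/m*o≡n/o (suc p) (2 * P * Q) (suc d) ⟨
    suc p * (2 * P * Q) / m              ≤⟨ /-monoˡ-≤ m wide-enough ⟩
    (4 * P * (P + 1) ∸ 1) / m            ≡⟨ cong (_/ m) width ⟨
    (windowHi P p ∸ windowLo P p) / m    ≤⟨ [m∸n]/o≤m/o∸n/o (windowHi P p) (windowLo P p) m ⟩
    windowHi P p / m ∸ windowLo P p / m  ≡⟨ countC≡ P p d 2P≤a 1≤b ⟨
    countC P p (suc d)                   ∎
    where
    open ≤-Reasoning
    m : ℕ
    m = suc p * suc d
    regroup : ∀ P → 2 * P * (P + P) + 4 * P ≡ 4 * P * (P + 1)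
    regroup = solve-∀
    wide-enough : suc p * (2 * P * Q) ≤ 4 * P * (P + 1) ∸ 1
    wide-enough = begin
      suc p * (2 * P * Q)             ≡⟨ scale 2 ⟩
      2 * P * (P + Q)                 ≤⟨ *-monoʳ-≤ (2 * P) (+-monoʳ-≤ P (m≤m*n Q p)) ⟩
      2 * P * (P + P)                 ≤⟨ m≤m+n _ (4 * P ∸ 1) ⟩
      2 * P * (P + P) + (4 * P ∸ 1)   ≡⟨ +-∸-assoc _ (≤-trans (≤-trans (s≤s z≤n) 2≤P) (m≤n*m P 4)) ⟨
      2 * P * (P + P) + 4 * P ∸ 1     ≡⟨ cong (_∸ 1) (regroup P) ⟩
      4 * P * (P + 1) ∸ 1             ∎

  countC-≤ : ∀ d → countC P p (suc d) ≤ suc ((4 * P * Q) / suc d)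
  countC-≤ d = begin
    countC P p (suc d)                       ≡⟨ countC≡ P p d 2P≤a 1≤b ⟩
    windowHi P p / m ∸ windowLo P p / m      ≤⟨ m/o∸n/o≤1+[m∸n]/o (windowHi P p) (windowLo P p) m ⟩
    suc ((windowHi P p ∸ windowLo P p) / m)  ≡⟨ cong (λ x → suc (x / m)) width ⟩
    suc ((4 * P * (P + 1) ∸ 1) / m)          ≤⟨ s≤s (/-monoˡ-≤ m narrow-enough) ⟩
    suc (suc p * (4 * P * Q) / m)            ≡⟨ cong suc (m*n/m*o≡n/o (suc p) (4 * P * Q) (suc d)) ⟩
    suc ((4 * P * Q) / suc d)                ∎
    where
    open ≤-Reasoning
    m : ℕ
    m = suc p * suc d
    narrow-enough : 4 * P * (P + 1) ∸ 1 ≤ suc p * (4 * P * Q)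
    narrow-enough = begin
      4 * P * (P + 1) ∸ 1             ≤⟨ m∸n≤m _ 1 ⟩
      4 * P * (P + 1)                 ≤⟨ *-monoʳ-≤ (4 * P) (+-monoʳ-≤ P 1≤Q) ⟩
      4 * P * (P + Q)                 ≡⟨ scale 4 ⟨
      suc p * (4 * P * Q)             ∎

  N≡sum : N P p ≡ sum (applyUpTo (λ i → countC P p (suc i)) (P ∸ 1))
  N≡sum = cong sum (map-applyUpTo suc (countC P p) (P ∸ 1))

  harmonic-≤-N : harmonic (2 * P * Q) (P ∸ 1) ≤ N P p
  harmonic-≤-N = subst (harmonic (2 * P * Q) (P ∸ 1) ≤_) (sym N≡sum)
                       (sum-applyUpTo-mono-≤ (P ∸ 1) (λ d _ → countC-≥ d))

  N-≤-harmonic : N P p ≤ (P ∸ 1) + harmonic (4 * P * Q) (P ∸ 1)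
  N-≤-harmonic = begin
    N P p                                                          ≡⟨ N≡sum ⟩
    sum (applyUpTo (λ i → countC P p (suc i)) (P ∸ 1))             ≤⟨ sum-applyUpTo-mono-≤ (P ∸ 1) (λ d _ → countC-≤ d) ⟩
    sum (applyUpTo (λ i → 1 + (4 * P * Q) / suc i) (P ∸ 1))        ≡⟨ sum-applyUpTo-distrib-+ (λ _ → 1) (λ i → (4 * P * Q) / suc i) (P ∸ 1) ⟩
    sum (applyUpTo (λ _ → 1) (P ∸ 1)) + harmonic (4 * P * Q) (P ∸ 1) ≡⟨ cong (_+ harmonic (4 * P * Q) (P ∸ 1)) (trans (sum-applyUpTo-const 1 (P ∸ 1)) (*-identityʳ (P ∸ 1))) ⟩
    (P ∸ 1) + harmonic (4 * P * Q) (P ∸ 1)                         ∎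
    where open ≤-Reasoning

  N-≥ : Q * P * ⌊log₂ P ⌋ ≤ 4 * N P p
  N-≥ = begin
    Q * P * L                          ≤⟨ *-monoʳ-≤ (Q * P) (n≤2*[n∸1] L (⌊log₂⌋-mono-≤ 4≤P)) ⟩
    Q * P * (2 * (L ∸ 1))              ≡⟨ regroup Q P (L ∸ 1) ⟩
    2 * P * Q * (L ∸ 1)                ≤⟨ *-monoʳ-≤ (2 * P * Q) (⌊log₂n⌋∸1≤⌊log₂[n∸1]⌋ P) ⟩
    2 * P * Q * ⌊log₂ (P ∸ 1) ⌋        ≤⟨ harmonic-≥ (2 * P * Q) (P ∸ 1) 2[P∸1]≤2PQ ⟩
    4 * harmonic (2 * P * Q) (P ∸ 1)   ≤⟨ *-monoʳ-≤ 4 harmonic-≤-N ⟩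
    4 * N P p                          ∎
    where
    open ≤-Reasoning
    L : ℕ
    L = ⌊log₂ P ⌋
    regroup : ∀ Q P l → Q * P * (2 * l) ≡ 2 * P * Q * l
    regroup = solve-∀
    2[P∸1]≤2PQ : 2 * (P ∸ 1) ≤ 2 * P * Q
    2[P∸1]≤2PQ = ≤-trans (*-monoʳ-≤ 2 (m∸n≤m P 1)) (m≤m*n (2 * P) Q)

  N-≤ : N P p ≤ 9 * (Q * P * ⌊log₂ P ⌋)
  N-≤ = begin
    N P p                                     ≤⟨ N-≤-harmonic ⟩
    (P ∸ 1) + harmonic (4 * P * Q) (P ∸ 1)    ≤⟨ +-mono-≤ (m∸n≤m P 1) (harmonic-≤ (4 * P * Q) (P ∸ 1)) ⟩
    P + 4 * P * Q * suc ⌊log₂ (P ∸ 1) ⌋       ≤⟨ +-monoʳ-≤ P (*-monoʳ-≤ (4 * P * Q) (s≤s (⌊log₂⌋-mono-≤ (m∸n≤m P 1)))) ⟩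
    P + 4 * P * Q * suc L                     ≤⟨ absorb P Q L 1≤Q (⌊log₂⌋-mono-≤ (≤-trans (s≤s (s≤s z≤n)) 4≤P)) ⟩
    9 * (Q * P * L)                           ∎
    where
    open ≤-Reasoning
    L : ℕ
    L = ⌊log₂ P ⌋
    absorb : ∀ P Q L → 1 ≤ Q → 1 ≤ L → P + 4 * P * Q * suc L ≤ 9 * (Q * P * L)
    absorb P (suc q) (suc l) _ _ = subst (P + 4 * P * suc q * 2+ l ≤_) (sym (expand P q l)) (m≤m+n _ (5 * P * suc q * l + P * q))
      where
      expand : ∀ P q l → 9 * (suc q * P * suc l) ≡ P + 4 * P * suc q * 2+ l + (5 * P * suc q * l + P * q)
      expand = solve-∀

n≤c*QPL⇒n^[1+t]≤c^[1+t]*P^[1+2t]*L^[1+t] : ∀ c t Q p L n → Q ≤ p ^ t → n ≤ c * (Q * (Q * p) * L) →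
  n ^ suc t ≤ c ^ suc t * ((Q * p) ^ (2 * suc t ∸ 1) * L ^ suc t)
n≤c*QPL⇒n^[1+t]≤c^[1+t]*P^[1+2t]*L^[1+t] c t Q p L n Q≤p^t n≤cQPL = begin
  n ^ s                                 ≤⟨ ^-monoˡ-≤ s n≤cQPL ⟩
  (c * (Q * P * L)) ^ s                 ≡⟨ [m*n]^o≡m^o*n^o c _ s ⟩
  c ^ s * (Q * P * L) ^ s               ≡⟨ cong (c ^ s *_) (trans ([m*n]^o≡m^o*n^o (Q * P) L s)
                                                                  (cong (_* L ^ s) ([m*n]^o≡m^o*n^o Q P s))) ⟩
  c ^ s * (Q ^ s * P ^ s * L ^ s)       ≤⟨ *-monoʳ-≤ (c ^ s) (*-monoˡ-≤ (L ^ s) (*-monoˡ-≤ (P ^ s) (m≤n^o⇒m^[1+o]≤[m*n]^o Q p t Q≤p^t))) ⟩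
  c ^ s * (P ^ t * P ^ s * L ^ s)       ≡⟨ cong (λ x → c ^ s * (x * L ^ s)) (^-distribˡ-+-* P t s) ⟨
  c ^ s * (P ^ (t + s) * L ^ s)         ≡⟨ cong (λ x → c ^ s * (P ^ (t + x) * L ^ s)) (+-identityʳ s) ⟨
  c ^ s * (P ^ (2 * s ∸ 1) * L ^ s)     ∎
  where
  open ≤-Reasoning
  s P : ℕ
  s = suc t
  P = Q * p

theorem5 : (k : ℕ) → 3 ≤ k →
    ∃[ c₁ ] ∃[ c₂ ] ∃[ c₃ ] ∃[ M ]
      ((qs : List ℕ) (p : ℕ) → Prime p → All Prime qs → Unique qs → All (_< p) qs →
        length qs ≡ k ∸ 3 → M ≤ product qs * p →
          (product qs * (product qs * p) * ⌊log₂ (product qs * p) ⌋ ≤ c₁ * N (product qs * p) p)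
          × (N (product qs * p) p ≤ c₂ * (product qs * (product qs * p) * ⌊log₂ (product qs * p) ⌋))
          × (N (product qs * p) p ^ (k ∸ 2)
               ≤ c₃ * ((product qs * p) ^ (2 * (k ∸ 2) ∸ 1) * ⌊log₂ (product qs * p) ⌋ ^ (k ∸ 2))))
theorem5 1 (s≤s ())
theorem5 2 (s≤s (s≤s ()))
theorem5 (suc (suc (suc t))) _ = 4 , 9 , 9 ^ suc t , 4 ,
  λ qs p p-prime _ _ qs<p |qs|≡t 4≤P →
    let 2≤p = nonTrivial⇒n>1 p {{prime⇒nonTrivial p-prime}}
        Q≤p^t = subst (λ n → product qs ≤ p ^ n) |qs|≡t (product≤^length qs (All.map <⇒≤ qs<p))
        upper = N-≤ (product qs) 2≤p 4≤P
    in N-≥ (product qs) 2≤p 4≤P , upper , n≤c*QPL⇒n^[1+t]≤c^[1+t]*P^[1+2t]*L^[1+t] 9 t (product qs) p ⌊log₂ (product qs * p) ⌋ _ Q≤p^t upper
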